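{- Every leaf block $A$ (block of degree $1$) of a pendant tree $T$ of a simple graph $G$ satisfies $|A|>\delta(G)$.
   Context: For $X\subseteq V$, $d_G(X)$ is the number of edges with exactly one endpoint in $X$. For vertices $v\neq w$, $\lambda_G(v,w)$ is the minimum of $d_G(X)$ over $X$ containing exactly one of $v,w$. A pair $\{v,w\}$ of distinct vertices is pendant if $\lambda_G(v,w)=\min\{d_G(v),d_G(w)\}$. For a tree $T$ whose vertex set (blocks) is a partition of $V$ and an edge $AB$ of $T$, $C_{AB}$ is the union of blocks in the component of $T-AB$ containing $A$, and $c(AB):=d_G(C_{AB})$. A pendant tree of $G$ is such a tree with: (i) every two distinct vertices in a common block form a pendant pair; (ii) for every edge $AB$ there are $a\in A$, $b\in B$ with $\{a,b\}$ non-pendant; (iii) for every edge $AB$ there are $a^*\in A$, $b^*\in B$ with $c(AB)=\lambda_G(a^*,b^*)$. -}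

module Defs where

open import Data.Nat using (ℕ; zero; suc; _+_; _*_; _⊓_; _<_)
open import Data.Bool using (Bool; true; false; _∧_; _∨_; not; if_then_else_)
open import Data.Fin using (Fin; zero; suc; _≟_)
open import Data.Product using (Σ; _×_; ∃; ∃-syntax)
open import Relation.Nullary using (¬_)
open import Relation.Nullary.Decidable using (⌊_⌋)
open import Relation.Binary.PropositionalEquality using (_≡_; _≢_)

_=ᶠ_ : ∀ {k} → Fin k → Fin k → Bool
i =ᶠ j = ⌊ i ≟ j ⌋

countFin : ∀ {k} → (Fin k → Bool) → ℕ
countFin {zero}  p = 0
countFin {suc k} p = (if p zero then 1 else 0) + countFin (λ i → p (suc i))

sumFin : ∀ {k} → (Fin k → ℕ) → ℕ
sumFin {zero}  g = 0
sumFin {suc k} g = g zero + sumFin (λ i → g (suc i))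

anyFin : ∀ {k} → (Fin k → Bool) → Bool
anyFin {zero}  p = false
anyFin {suc k} p = p zero ∨ anyFin (λ i → p (suc i))

-- minimum of g over all vertices (default value used only when k = 0)
minFin : ∀ {k} → ℕ → (Fin k → ℕ) → ℕ
minFin {zero}  d g = d
minFin {suc k} d g = g zero ⊓ minFin d (λ i → g (suc i))

-- minimum of g over ALL subsets X ⊆ Fin k (subsets as characteristic functions)
minSubsets : (k : ℕ) → ((Fin k → Bool) → ℕ) → ℕ
minSubsets zero    g = g (λ ())
minSubsets (suc k) g =
  minSubsets k (λ X → g (λ { zero → false ; (suc i) → X i }))
  ⊓ minSubsets k (λ X → g (λ { zero → true ; (suc i) → X i }))

record SimpleGraph (n : ℕ) : Set where
  field
    adj   : Fin n → Fin n → Bool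
    sym   : ∀ u v → adj u v ≡ adj v u
    irrefl : ∀ v → adj v v ≡ false

module _ {n : ℕ} (G : SimpleGraph n) where
  open SimpleGraph G

  -- d_G(X): number of edges with exactly one endpoint in X
  -- (each such edge counted once, as the ordered pair (u ∈ X, v ∉ X))
  cut : (Fin n → Bool) → ℕ
  cut X = sumFin (λ u → countFin (λ v → X u ∧ not (X v) ∧ adj u v))

  deg : Fin n → ℕ
  deg v = cut (λ u → u =ᶠ v)

  -- minimum degree δ(G)  (for n = 0 the value is irrelevant)
  δ : ℕ
  δ = minFin n deg

  separates : (Fin n → Bool) → Fin n → Fin n → Bool
  separates X v w = (X v ∧ not (X w)) ∨ (X w ∧ not (X v))

  -- λ_G(v,w) = min { d_G(X) : X contains exactly one of v,w }
  -- non-separating X get the value n*n, which is ≥ every d_G(X)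
  λG : Fin n → Fin n → ℕ
  λG v w = minSubsets n (λ X → if separates X v w then cut X else n * n)

  Pendant : Fin n → Fin n → Set
  Pendant v w = (v ≢ w) × (λG v w ≡ deg v ⊓ deg w)

reach : ∀ {m} → (Fin m → Fin m → Bool) → Fin m → ℕ → Fin m → Bool
reach a s zero    v = s =ᶠ v
reach a s (suc k) v = reach a s k v ∨ anyFin (λ u → reach a s k u ∧ a u v)

deleteEdge : ∀ {m} → (Fin m → Fin m → Bool) → Fin m → Fin m → Fin m → Fin m → Bool
deleteEdge a A B u v = a u v ∧ not (((u =ᶠ A) ∧ (v =ᶠ B)) ∨ ((u =ᶠ B) ∧ (v =ᶠ A)))

-- A tree on block set Fin m: symmetric irreflexive adjacency, connected,
-- and minimally connected (every edge is a bridge)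
record IsTree (m : ℕ) (tadj : Fin m → Fin m → Bool) : Set where
  field
    sym       : ∀ A B → tadj A B ≡ tadj B A
    irrefl    : ∀ A → tadj A A ≡ false
    connected : ∀ A B → reach tadj A m B ≡ true
    bridges   : ∀ A B → tadj A B ≡ true → reach (deleteEdge tadj A B) A m B ≡ false

-- A pendant tree of G: a partition of V(G) into m nonempty blocks
-- (block v = the block containing v) together with a tree on the blocks
record PendantTree {n : ℕ} (G : SimpleGraph n) : Set where
  field
    m        : ℕ
    block    : Fin n → Fin m
    nonempty : ∀ A → ∃[ v ] block v ≡ A
    tadj     : Fin m → Fin m → Bool
    isTree   : IsTree m tadj

  -- C_AB: union of the blocks in the component of T - AB containing A
  C : Fin m → Fin m → (Fin n → Bool)
  C A B v = reach (deleteEdge tadj A B) A m (block v)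

  c : Fin m → Fin m → ℕ
  c A B = cut G (C A B)

  size : Fin m → ℕ
  size A = countFin (λ v → block v =ᶠ A)

  tdeg : Fin m → ℕ
  tdeg A = countFin (tadj A)

  field
    cond-i   : ∀ v w → v ≢ w → block v ≡ block w → Pendant G v w
    cond-ii  : ∀ A B → tadj A B ≡ true →
               ∃[ a ] ∃[ b ] (block a ≡ A × block b ≡ B × ¬ Pendant G a b)
    cond-iii : ∀ A B → tadj A B ≡ true →
               ∃[ a ] ∃[ b ] (block a ≡ A × block b ≡ B × c A B ≡ λG G a b)

module Submission where

-- Let B be the unique neighbour of A.  Then C_AB = A, so c(AB) = d(A).
-- By (ii) there are a ∈ A, b ∈ B with {a,b} non-pendant, and by (iii)
-- there are a* ∈ A, b* ∈ B with d(A) = λ(a*,b*).  Suppose |A| ≤ δ.  Then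
-- every vertex of A has fewer neighbours inside A than its degree, hence a
-- neighbour outside A, and counting gives d(a) ≤ d(A) = λ(a*,b*).  Now the
-- "ultrametric" inequality λ(x,y) ≥ min(λ(x,z), λ(z,y)), applied along
-- a – a* – b* – b, together with (i) for the pairs {a,a*} ⊆ A and
-- {b*,b} ⊆ B, yields λ(a,b) ≥ min(d(a), d(b)), i.e. {a,b} is pendant:
-- a contradiction.

open import Defs
open import Data.Nat using (ℕ; zero; suc; _+_; _*_; _⊓_; _<_; _≤_; _≤?_; z≤n; s≤s)
open import Data.Nat.Properties hiding (_≟_)
open import Data.Bool using (Bool; true; false; _∧_; _∨_; not; if_then_else_)
open import Data.Bool.Properties using (∧-identityʳ; ∨-identityʳ)
open import Data.Fin using (Fin; zero; suc; _≟_)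
open import Data.Product using (_×_; ∃-syntax; _,_; proj₂)
open import Data.Sum using (_⊎_; inj₁; inj₂)
open import Function using (_∘_)
open import Relation.Nullary using (yes; no; contradiction)
open import Relation.Binary.PropositionalEquality
open import Algebra.Properties.CommutativeSemigroup +-commutativeSemigroup using (x∙yz≈y∙xz)

=ᶠ-true : ∀ {k} {i j : Fin k} → i ≡ j → (i =ᶠ j) ≡ true
=ᶠ-true {i = i} {j} i≡j with i ≟ j
... | yes _   = refl
... | no i≢j = contradiction i≡j i≢j

=ᶠ-false : ∀ {k} {i j : Fin k} → i ≢ j → (i =ᶠ j) ≡ false
=ᶠ-false {i = i} {j} i≢j with i ≟ j
... | yes i≡j = contradiction i≡j i≢j
... | no _    = refl

=ᶠ-sym : ∀ {k} (i j : Fin k) → (i =ᶠ j) ≡ (j =ᶠ i)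
=ᶠ-sym i j with i ≟ j | j ≟ i
... | yes _   | yes _   = refl
... | no _    | no _    = refl
... | yes i≡j | no j≢i = contradiction (sym i≡j) j≢i
... | no i≢j | yes j≡i = contradiction (sym j≡i) i≢j

=ᶠ-suc : ∀ {k} (i j : Fin k) → (Fin.suc i =ᶠ Fin.suc j) ≡ (i =ᶠ j)
=ᶠ-suc i j with i ≟ j
... | yes _ = refl
... | no _  = refl

countFin-ext : ∀ {k} {p q : Fin k → Bool} → (∀ i → p i ≡ q i) → countFin p ≡ countFin q
countFin-ext {zero}  p≗q = refl
countFin-ext {suc k} p≗q rewrite p≗q zero = cong (_ +_) (countFin-ext (p≗q ∘ suc))

sumFin-ext : ∀ {k} {f g : Fin k → ℕ} → (∀ i → f i ≡ g i) → sumFin f ≡ sumFin g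
sumFin-ext {zero}  f≗g = refl
sumFin-ext {suc k} f≗g = cong₂ _+_ (f≗g zero) (sumFin-ext (f≗g ∘ suc))

countFin-none : ∀ {k} {p : Fin k → Bool} → (∀ i → p i ≡ false) → countFin p ≡ 0
countFin-none {zero}  none = refl
countFin-none {suc k} none rewrite none zero = countFin-none (none ∘ suc)

anyFin-none : ∀ {k} {p : Fin k → Bool} → (∀ i → p i ≡ false) → anyFin p ≡ false
anyFin-none {zero}  none = refl
anyFin-none {suc k} none rewrite none zero = anyFin-none (none ∘ suc)

sumFin-zero : ∀ {k} {f : Fin k → ℕ} → (∀ i → f i ≡ 0) → sumFin f ≡ 0
sumFin-zero {zero}  zeros = refl
sumFin-zero {suc k} zeros rewrite zeros zero = sumFin-zero (zeros ∘ suc)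

countFin-≤ : ∀ {k} (p : Fin k → Bool) → countFin p ≤ k
countFin-≤ {zero}  p = z≤n
countFin-≤ {suc k} p with p zero
... | true  = s≤s (countFin-≤ (p ∘ suc))
... | false = m≤n⇒m≤1+n (countFin-≤ (p ∘ suc))

countFin-mono : ∀ {k} {p q : Fin k → Bool} → (∀ i → p i ≡ true → q i ≡ true) →
                countFin p ≤ countFin q
countFin-mono {zero}          p⊆q = z≤n
countFin-mono {suc k} {p} {q} p⊆q with p zero in ep | q zero in eq
... | false | false = countFin-mono (p⊆q ∘ suc)
... | false | true  = m≤n⇒m≤1+n (countFin-mono (p⊆q ∘ suc))
... | true  | true  = s≤s (countFin-mono (p⊆q ∘ suc))
... | true  | false = contradiction (trans (sym (p⊆q zero ep)) eq) λ ()

countFin-split : ∀ {k} (q p : Fin k → Bool) →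
                 countFin p ≡ countFin (λ i → q i ∧ p i) + countFin (λ i → not (q i) ∧ p i)
countFin-split {zero}  q p = refl
countFin-split {suc k} q p with q zero | p zero
... | true  | true  = cong suc (countFin-split (q ∘ suc) (p ∘ suc))
... | true  | false = countFin-split (q ∘ suc) (p ∘ suc)
... | false | true  = trans (cong suc (countFin-split (q ∘ suc) (p ∘ suc))) (sym (+-suc _ _))
... | false | false = countFin-split (q ∘ suc) (p ∘ suc)

countFin-remove : ∀ {k} (p : Fin k → Bool) (a : Fin k) → p a ≡ true →
                  countFin p ≡ suc (countFin (λ i → p i ∧ not (i =ᶠ a)))
countFin-remove {suc k} p zero    pa rewrite pa =
  cong suc (countFin-ext (λ i → sym (∧-identityʳ (p (suc i)))))
countFin-remove {suc k} p (suc a) pa with p zero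
... | true  = cong suc (trans (countFin-remove (p ∘ suc) a pa) (cong suc (countFin-ext shift)))
  where shift = λ i → cong (λ b → p (suc i) ∧ not b) (sym (=ᶠ-suc i a))
... | false = trans (countFin-remove (p ∘ suc) a pa) (cong suc (countFin-ext shift))
  where shift = λ i → cong (λ b → p (suc i) ∧ not b) (sym (=ᶠ-suc i a))

sumFin-remove : ∀ {k} (f : Fin k → ℕ) (a : Fin k) →
                sumFin f ≡ f a + sumFin (λ u → if u =ᶠ a then 0 else f u)
sumFin-remove {suc k} f zero    = refl
sumFin-remove {suc k} f (suc a) = begin
  f zero + sumFin (f ∘ suc)             ≡⟨ cong (f zero +_) (sumFin-remove (f ∘ suc) a) ⟩
  f zero + (f (suc a) + rest)           ≡⟨ x∙yz≈y∙xz (f zero) (f (suc a)) rest ⟩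
  f (suc a) + (f zero + rest)           ≡⟨ cong (λ s → f (suc a) + (f zero + s)) (sumFin-ext shift) ⟩
  f (suc a) + (f zero + sumFin (λ i → if suc i =ᶠ suc a then 0 else f (suc i))) ∎
  where
  open ≡-Reasoning
  rest = sumFin (λ i → if i =ᶠ a then 0 else f (suc i))
  shift = λ i → cong (λ b → if b then 0 else f (suc i)) (sym (=ᶠ-suc i a))

sumFin-single : ∀ {k} (f : Fin k → ℕ) (a : Fin k) → (∀ u → u ≢ a → f u ≡ 0) → sumFin f ≡ f a
sumFin-single f a off = begin
  sumFin f                                          ≡⟨ sumFin-remove f a ⟩
  f a + sumFin (λ u → if u =ᶠ a then 0 else f u)    ≡⟨ cong (f a +_) (sumFin-zero vanish) ⟩
  f a + 0                                           ≡⟨ +-identityʳ (f a) ⟩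
  f a                                               ∎
  where
  open ≡-Reasoning
  vanish : ∀ u → (if u =ᶠ a then 0 else f u) ≡ 0
  vanish u with u ≟ a
  ... | yes _   = refl
  ... | no u≢a = off u u≢a

countFin-≤-sumFin : ∀ {k} (f : Fin k → ℕ) (q : Fin k → Bool) → (∀ u → q u ≡ true → 1 ≤ f u) →
                    countFin q ≤ sumFin f
countFin-≤-sumFin {zero}  f q pos = z≤n
countFin-≤-sumFin {suc k} f q pos with q zero in e
... | true  = +-mono-≤ (pos zero e) (countFin-≤-sumFin (f ∘ suc) (q ∘ suc) (pos ∘ suc))
... | false = ≤-trans (countFin-≤-sumFin (f ∘ suc) (q ∘ suc) (pos ∘ suc)) (m≤n+m _ _)

countFin-witness : ∀ {k} (p : Fin k → Bool) → 1 ≤ countFin p → ∃[ i ] p i ≡ true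
countFin-witness {suc k} p pos with p zero in e
... | true  = zero , e
... | false with countFin-witness (p ∘ suc) pos
...   | i , pi = suc i , pi

countFin-unique : ∀ {k} (p : Fin k → Bool) → countFin p ≡ 1 →
                  ∃[ b ] (p b ≡ true × ∀ v → p v ≡ true → v ≡ b)
countFin-unique p one with countFin-witness p (≤-reflexive (sym one))
... | b , pb = b , pb , only-b
  where
  others-empty : countFin (λ i → p i ∧ not (i =ᶠ b)) ≡ 0
  others-empty = suc-injective (trans (sym (countFin-remove p b pb)) one)
  only-b : ∀ v → p v ≡ true → v ≡ b
  only-b v pv with v ≟ b
  ... | yes v≡b = v≡b
  ... | no v≢b  = contradiction (trans (sym others-empty) (countFin-remove _ v other)) 0≢1+n
    where
    other : (p v ∧ not (v =ᶠ b)) ≡ true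
    other rewrite pv | =ᶠ-false v≢b = refl

minFin-≤ : ∀ {k} d (g : Fin k → ℕ) (i : Fin k) → minFin d g ≤ g i
minFin-≤ d g zero    = m⊓n≤m _ _
minFin-≤ d g (suc i) = m≤n⇒o⊓m≤n _ (minFin-≤ d (g ∘ suc) i)

Extensional : ∀ k → ((Fin k → Bool) → ℕ) → Set
Extensional k g = ∀ {X Y} → (∀ i → X i ≡ Y i) → g X ≡ g Y

minSubsets-glb : ∀ k (g : (Fin k → Bool) → ℕ) L → (∀ X → L ≤ g X) → L ≤ minSubsets k g
minSubsets-glb zero    g L below = below _
minSubsets-glb (suc k) g L below =
  ⊓-glb (minSubsets-glb k _ L (λ X → below _)) (minSubsets-glb k _ L (λ X → below _))

minSubsets-≤ : ∀ k (g : (Fin k → Bool) → ℕ) → Extensional k g → ∀ X → minSubsets k g ≤ g X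
minSubsets-≤ zero    g ext X = ≤-reflexive (ext λ ())
minSubsets-≤ (suc k) g ext X with X zero in e
... | false = m≤n⇒m⊓o≤n _ (≤-trans
    (minSubsets-≤ k _ (λ Y≗Z → ext (λ { zero → refl ; (suc i) → Y≗Z i })) (X ∘ suc))
    (≤-reflexive (ext (λ { zero → sym e ; (suc i) → refl }))))
... | true  = m≤n⇒o⊓m≤n _ (≤-trans
    (minSubsets-≤ k _ (λ Y≗Z → ext (λ { zero → refl ; (suc i) → Y≗Z i })) (X ∘ suc))
    (≤-reflexive (ext (λ { zero → sym e ; (suc i) → refl }))))

module _ {n : ℕ} (G : SimpleGraph n) where
  open SimpleGraph G using (adj; irrefl)

  separated⇒≢ : ∀ {X x y} → separates G X x y ≡ true → x ≢ y
  separated⇒≢ {X} {x} e refl with X x | e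
  ... | true  | ()
  ... | false | ()

  separates-split : ∀ X x y z → separates G X x y ≡ true →
                    separates G X x z ≡ true ⊎ separates G X z y ≡ true
  separates-split X x y z e with X x | X y | X z | e
  ... | true  | false | true  | _ = inj₂ refl
  ... | true  | false | false | _ = inj₁ refl
  ... | false | true  | true  | _ = inj₁ refl
  ... | false | true  | false | _ = inj₂ refl
  ... | true  | true  | _     | ()
  ... | false | false | _     | ()

  separates-inₗ : ∀ X {x y} → X x ≡ true → X y ≡ false → separates G X x y ≡ true
  separates-inₗ X x∈X y∉X rewrite x∈X | y∉X = refl

  separates-inᵣ : ∀ X {x y} → X x ≡ false → X y ≡ true → separates G X x y ≡ true
  separates-inᵣ X x∉X y∈X rewrite x∉X | y∈X = refl

  cut-ext : Extensional n (cut G)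
  cut-ext X≗Y = sumFin-ext (λ u → countFin-ext (λ v →
    cong₂ (λ x y → x ∧ not y ∧ adj u v) (X≗Y u) (X≗Y v)))

  separationCost : Fin n → Fin n → (Fin n → Bool) → ℕ
  separationCost v w X = if separates G X v w then cut G X else n * n

  separationCost-ext : ∀ v w → Extensional n (separationCost v w)
  separationCost-ext v w X≗Y = cong₂ (λ s c → if s then c else n * n)
    (cong₂ (λ x y → (x ∧ not y) ∨ (y ∧ not x)) (X≗Y v) (X≗Y w)) (cut-ext X≗Y)

  λG-≤-cut : ∀ v w X → separates G X v w ≡ true → λG G v w ≤ cut G X
  λG-≤-cut v w X sep = ≤-trans (minSubsets-≤ n _ (separationCost-ext v w) X) (≤-reflexive cost)
    where
    cost : separationCost v w X ≡ cut G X
    cost rewrite sep = refl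

  λG-≤-n*n : ∀ v w → λG G v w ≤ n * n
  λG-≤-n*n v w = minSubsets-≤ n _ (separationCost-ext v w) (λ _ → false)

  λG-glb : ∀ v w L → (∀ X → separates G X v w ≡ true → L ≤ cut G X) → L ≤ n * n → L ≤ λG G v w
  λG-glb v w L below L≤n*n = minSubsets-glb n _ L below-cost
    where
    below-cost : ∀ X → L ≤ separationCost v w X
    below-cost X with separates G X v w in sep
    ... | true  = below X sep
    ... | false = L≤n*n

  λG-ultrametric : ∀ x y z → λG G x z ⊓ λG G z y ≤ λG G x y
  λG-ultrametric x y z = λG-glb x y _ below (m≤n⇒m⊓o≤n _ (λG-≤-n*n x z))
    where
    below : ∀ X → separates G X x y ≡ true → λG G x z ⊓ λG G z y ≤ cut G X
    below X sep with separates-split X x y z sep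
    ... | inj₁ sep-xz = m≤n⇒m⊓o≤n _ (λG-≤-cut x z X sep-xz)
    ... | inj₂ sep-zy = m≤n⇒o⊓m≤n _ (λG-≤-cut z y X sep-zy)

  -- Since no set separates x from x, λ(x,x) takes the default value n².
  λG-diag : ∀ x → n * n ≤ λG G x x
  λG-diag x = λG-glb x x (n * n) (λ X sep → contradiction refl (separated⇒≢ {X} sep)) ≤-refl

  deg-countFin : ∀ u → deg G u ≡ countFin (adj u)
  deg-countFin u = trans (sumFin-single _ u other-rows) (countFin-ext own-row)
    where
    other-rows : ∀ u' → u' ≢ u → countFin (λ v → (u' =ᶠ u) ∧ not (v =ᶠ u) ∧ adj u' v) ≡ 0
    other-rows u' u'≢u rewrite =ᶠ-false {i = u'} {u} u'≢u = countFin-none {n} (λ _ → refl)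
    own-row : ∀ v → ((u =ᶠ u) ∧ not (v =ᶠ u) ∧ adj u v) ≡ adj u v
    own-row v rewrite =ᶠ-true {i = u} refl with v ≟ u
    ... | yes refl = sym (irrefl u)
    ... | no _     = refl

  deg-≤-n*n : ∀ u → deg G u ≤ n * n
  deg-≤-n*n u = ≤-trans (≤-reflexive (deg-countFin u)) (≤-trans (countFin-≤ (adj u)) (n≤n*n n))
    where
    n≤n*n : ∀ k → k ≤ k * k
    n≤n*n zero    = z≤n
    n≤n*n (suc k) = m≤m*n (suc k) (suc k)

  -- The cuts of {v} and {w} give λ(v,w) ≤ min(d(v), d(w)).
  λG-≤-degₗ : ∀ {v w} → v ≢ w → λG G v w ≤ deg G v
  λG-≤-degₗ {v} {w} v≢w = λG-≤-cut v w (_=ᶠ v)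
    (separates-inₗ (_=ᶠ v) (=ᶠ-true {i = v} refl) (=ᶠ-false (v≢w ∘ sym)))

  λG-≤-degᵣ : ∀ {v w} → v ≢ w → λG G v w ≤ deg G w
  λG-≤-degᵣ {v} {w} v≢w = λG-≤-cut v w (_=ᶠ w)
    (separates-inᵣ (_=ᶠ w) (=ᶠ-false v≢w) (=ᶠ-true {i = w} refl))

  pendant-transfer : ∀ {a b a* b*} → a ≢ b → a* ≢ b* →
                     deg G a ≤ λG G a* b* →
                     deg G a ⊓ deg G a* ≤ λG G a a* →
                     deg G b* ⊓ deg G b ≤ λG G b* b →
                     Pendant G a b
  pendant-transfer {a} {b} {a*} {b*} a≢b a*≢b* da≤λ* tight-a tight-b =
    a≢b , ≤-antisym (⊓-glb (λG-≤-degₗ a≢b) (λG-≤-degᵣ a≢b)) lower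
    where
    da≤da* : deg G a ≤ deg G a*
    da≤da* = ≤-trans da≤λ* (λG-≤-degₗ a*≢b*)
    da≤db* : deg G a ≤ deg G b*
    da≤db* = ≤-trans da≤λ* (λG-≤-degᵣ a*≢b*)
    via-a* : deg G a ⊓ deg G b ≤ λG G a a*
    via-a* = m≤n⇒m⊓o≤n _ (≤-trans (⊓-glb ≤-refl da≤da*) tight-a)
    via-a*b* : deg G a ⊓ deg G b ≤ λG G a* b*
    via-a*b* = m≤n⇒m⊓o≤n _ da≤λ*
    via-b* : deg G a ⊓ deg G b ≤ λG G b* b
    via-b* = ≤-trans (⊓-mono-≤ da≤db* ≤-refl) tight-b
    lower : deg G a ⊓ deg G b ≤ λG G a b
    lower = ≤-trans (⊓-glb via-a* (≤-trans (⊓-glb via-a*b* via-b*) (λG-ultrametric a* b b*)))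
                    (λG-ultrametric a b a*)

  -- A set S with |S| ≤ δ(G): each member has fewer neighbours in S than its
  -- degree, hence a neighbour outside S, and so d(a) ≤ d(S) for a ∈ S.
  module _ (S : Fin n → Bool) where
    outDeg : Fin n → ℕ
    outDeg u = countFin (λ v → not (S v) ∧ adj u v)

    othersIn : Fin n → ℕ
    othersIn u = countFin (λ v → S v ∧ not (v =ᶠ u))

    -- d(u) ≤ |S \ {u}| + outDeg u, since G has no loops.
    deg-≤-others+out : ∀ u → deg G u ≤ othersIn u + outDeg u
    deg-≤-others+out u = begin
      deg G u                                        ≡⟨ deg-countFin u ⟩
      countFin (adj u)                               ≡⟨ countFin-split S (adj u) ⟩
      countFin (λ v → S v ∧ adj u v) + outDeg u      ≤⟨ +-monoˡ-≤ (outDeg u) (countFin-mono inside) ⟩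
      othersIn u + outDeg u                          ∎
      where
      open ≤-Reasoning
      inside : ∀ v → (S v ∧ adj u v) ≡ true → (S v ∧ not (v =ᶠ u)) ≡ true
      inside v h with S v | adj u v in uv | v ≟ u
      ... | true  | true  | no _    = refl
      ... | true  | true  | yes refl = contradiction (trans (sym uv) (irrefl u)) λ ()
      ... | true  | false | _       = contradiction h λ ()
      ... | false | _     | _       = contradiction h λ ()

    outDeg-pos : countFin S ≤ δ G → ∀ u → S u ≡ true → 1 ≤ outDeg u
    outDeg-pos small u u∈S = +-cancelˡ-≤ (othersIn u) 1 (outDeg u) (begin
      othersIn u + 1        ≡⟨ +-comm (othersIn u) 1 ⟩
      suc (othersIn u)      ≡⟨ sym (countFin-remove S u u∈S) ⟩
      countFin S            ≤⟨ small ⟩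
      δ G                   ≤⟨ minFin-≤ n (deg G) u ⟩
      deg G u               ≤⟨ deg-≤-others+out u ⟩
      othersIn u + outDeg u ∎)
      where open ≤-Reasoning

    boundaryAt : Fin n → ℕ
    boundaryAt u = countFin (λ v → S u ∧ not (S v) ∧ adj u v)

    -- If |S| ≤ δ, then d(a) ≤ d(S) for a ∈ S: d(S) collects outDeg a from a
    -- and at least one edge from each of the |S| - 1 other members.
    deg-≤-cut : countFin S ≤ δ G → ∀ a → S a ≡ true → deg G a ≤ cut G S
    deg-≤-cut small a a∈S = begin
      deg G a                     ≤⟨ deg-≤-others+out a ⟩
      othersIn a + outDeg a       ≡⟨ +-comm (othersIn a) (outDeg a) ⟩
      outDeg a + othersIn a       ≤⟨ +-mono-≤ (≤-reflexive (sym boundaryAt-a)) (countFin-≤-sumFin _ _ others-pos) ⟩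
      boundaryAt a + sumFin (λ u → if u =ᶠ a then 0 else boundaryAt u) ≡⟨ sym (sumFin-remove boundaryAt a) ⟩
      cut G S                     ∎
      where
      open ≤-Reasoning
      boundaryAt-a : boundaryAt a ≡ outDeg a
      boundaryAt-a rewrite a∈S = refl
      others-pos : ∀ u → (S u ∧ not (u =ᶠ a)) ≡ true → 1 ≤ (if u =ᶠ a then 0 else boundaryAt u)
      others-pos u h with S u in u∈S | u ≟ a
      ... | true  | no _  = outDeg-pos small u u∈S
      ... | true  | yes _ = contradiction h λ ()
      ... | false | _     = contradiction h λ ()

leaf-isolated : ∀ {m} (t : Fin m → Fin m → Bool) {A B} → (∀ v → t A v ≡ true → v ≡ B) →
                ∀ w → deleteEdge t A B A w ≡ false
leaf-isolated t {A} {B} onlyB w with t A w in Aw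
... | false = refl
... | true rewrite onlyB w Aw | =ᶠ-true {i = A} refl | =ᶠ-true {i = B} refl = refl

leaf-component : ∀ {m} (t : Fin m → Fin m → Bool) {A B} → (∀ v → t A v ≡ true → v ≡ B) →
                 ∀ k v → reach (deleteEdge t A B) A k v ≡ (A =ᶠ v)
leaf-component t onlyB zero    v = refl
leaf-component t {A} {B} onlyB (suc k) v rewrite leaf-component t onlyB k v =
  trans (cong ((A =ᶠ v) ∨_) (anyFin-none no-step)) (∨-identityʳ (A =ᶠ v))
  where
  no-step : ∀ u → (reach (deleteEdge t A B) A k u ∧ deleteEdge t A B u v) ≡ false
  no-step u rewrite leaf-component t onlyB k u with A ≟ u
  ... | yes refl = leaf-isolated t onlyB v
  ... | no _     = refl

module _ {n : ℕ} {G : SimpleGraph n} (T : PendantTree G) where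
  open PendantTree T

  members : Fin m → Fin n → Bool
  members A v = block v =ᶠ A

  adjacent-blocks-≢ : ∀ {A B x y} → tadj A B ≡ true → block x ≡ A → block y ≡ B → x ≢ y
  adjacent-blocks-≢ {A} A~B x∈A y∈B refl with trans (sym x∈A) y∈B
  ... | refl = contradiction (trans (sym A~B) (IsTree.irrefl isTree A)) λ ()

  same-block-tight : ∀ {x y} → block x ≡ block y → deg G x ⊓ deg G y ≤ λG G x y
  same-block-tight {x} {y} same with x ≟ y
  ... | yes refl = ≤-trans (m⊓n≤m _ _) (≤-trans (deg-≤-n*n G x) (λG-diag G x))
  ... | no x≢y   = ≤-reflexive (sym (proj₂ (cond-i x y x≢y same)))

  leaf-edge : ∀ {A} → tdeg A ≡ 1 → ∃[ B ] (tadj A B ≡ true × c A B ≡ cut G (members A))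
  leaf-edge {A} leaf with countFin-unique (tadj A) leaf
  ... | B , A~B , onlyB = B , A~B , cut-ext G component-is-A
    where
    component-is-A : ∀ v → C A B v ≡ members A v
    component-is-A v = trans (leaf-component tadj onlyB m (block v)) (=ᶠ-sym A (block v))

lemma9 : ∀ {n} (G : SimpleGraph n) (T : PendantTree G) (A : Fin (PendantTree.m T)) →
         PendantTree.tdeg T A ≡ 1 → δ G < PendantTree.size T A
lemma9 G T A leaf with leaf-edge T leaf
... | B , A~B , cAB≡dA with PendantTree.cond-ii T A B A~B | PendantTree.cond-iii T A B A~B
... | a , b , a∈A , b∈B , non-pendant | a* , b* , a*∈A , b*∈B , cAB≡λ*
  with PendantTree.size T A ≤? δ G
... | no large  = ≰⇒> large
... | yes small = contradiction pendant non-pendant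
  where
  open PendantTree T
  da≤λ* : deg G a ≤ λG G a* b*
  da≤λ* = begin
    deg G a             ≤⟨ deg-≤-cut G (members T A) small a (=ᶠ-true a∈A) ⟩
    cut G (members T A) ≡⟨ sym cAB≡dA ⟩
    c A B               ≡⟨ cAB≡λ* ⟩
    λG G a* b*          ∎
    where open ≤-Reasoning
  pendant : Pendant G a b
  pendant = pendant-transfer G (adjacent-blocks-≢ T A~B a∈A b∈B) (adjacent-blocks-≢ T A~B a*∈A b*∈B)
    da≤λ* (same-block-tight T (trans a∈A (sym a*∈A))) (same-block-tight T (trans b*∈B (sym b∈B)))
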